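{- Let $n\ge1$ and let $\sigma$ be an orbit of $\mathbb{Z}/(2^n+1)-\{0\}$ under multiplication by $2$. Then the length $|\sigma|$ is even and $a(\sigma)$ is odd.
   Context: Identify $\mathbb{Z}/(2^n+1)-\{0\}$ with $\{1,\dots,2^n\}$. An orbit is written as a cyclic sequence $\sigma=(\sigma_1,\dots,\sigma_r)$ with $\sigma_{i+1}\equiv2\sigma_i\bmod 2^n+1$, indices mod $r$ ($\sigma_0=\sigma_r$); its length is $|\sigma|=r$. An entry $\sigma_i$ is a local maximum if $\sigma_{i-1}<\sigma_i>\sigma_{i+1}$ (as integers), and $a(\sigma)$ is the number of local maxima of $\sigma$ (which equals the number of local minima). -}

module Defs where

open import Data.Nat using (ℕ; zero; suc; _+_; _*_; _^_; _≤_; _<_; _<?_)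
open import Data.Nat.DivMod using (_%_; m%n<n)
open import Data.Fin using (Fin; toℕ; fromℕ<)
open import Data.List using (List; length; filter; allFin)
open import Data.Product using (_×_)
open import Relation.Nullary.Decidable using (_×-dec_)
open import Relation.Binary.PropositionalEquality using (_≡_)
open import Function.Definitions using (Injective)

modulus : ℕ → ℕ
modulus n = suc (2 ^ n)

-- Cyclic successor / predecessor of an index in Fin r, r = suc k
-- (indices taken mod r).
nextIdx : {k : ℕ} → Fin (suc k) → Fin (suc k)
nextIdx {k} i = fromℕ< (m%n<n (suc (toℕ i)) (suc k))

prevIdx : {k : ℕ} → Fin (suc k) → Fin (suc k)
prevIdx {k} i = fromℕ< (m%n<n (toℕ i + k) (suc k))

-- σ : Fin (suc k) → ℕ is (a cyclic listing of) an orbit of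
-- Z/(2^n+1) - {0} under multiplication by 2, where Z/(2^n+1) - {0} is
-- identified with {1,...,2^n}: every entry lies in {1,...,2^n},
-- σ_{i+1} ≡ 2 σ_i mod 2^n+1 (indices mod r), and the entries are
-- pairwise distinct (so r is exactly the orbit length).
record IsOrbit (n k : ℕ) (σ : Fin (suc k) → ℕ) : Set where
  field
    entry-pos   : ∀ i → 1 ≤ σ i
    entry-bound : ∀ i → σ i ≤ 2 ^ n
    doubling    : ∀ i → σ (nextIdx i) ≡ (2 * σ i) % modulus n
    distinct    : Injective _≡_ _≡_ σ

orbitLength : {k : ℕ} → (Fin (suc k) → ℕ) → ℕ
orbitLength {k} _ = suc k

IsLocalMax : {k : ℕ} → (Fin (suc k) → ℕ) → Fin (suc k) → Set
IsLocalMax σ i = (σ (prevIdx i) < σ i) × (σ (nextIdx i) < σ i)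

numLocalMax : {k : ℕ} → (Fin (suc k) → ℕ) → ℕ
numLocalMax {k} σ =
  length (filter (λ i → (σ (prevIdx i) <? σ i) ×-dec (σ (nextIdx i) <? σ i)) (allFin (suc k)))

module Submission where

-- Let σ be an orbit of multiplication by 2 on Z/(2^n+1) - {0}, listed as
-- σ_0, …, σ_{r-1} and extended r-periodically to a sequence σ̂ on ℕ.
--
-- Since 2^n ≡ -1 (mod 2^n+1), shifting by n negates: σ̂(j+n) = M - σ̂(j),
-- where M = 2^n+1.  As M is odd, no x satisfies x = M - x, so n is not a
-- multiple of r, while 2n is; with h = n mod r this forces r = 2h, so the
-- length is even.  Moreover x ↦ M - x reverses order, hence the descent
-- indicator b(j) = [σ̂(j+1) < σ̂(j)] is antiperiodic: b(j+h) = not b(j).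
--
-- A local maximum at j is a rise followed by a fall: not b(j-1) ∧ b(j).
-- For any antiperiodic Boolean sequence the parity of the number of such
-- j in a period of length 2h is computed by pairing j with j+h and
-- telescoping; it is always odd.

open import Defs
open import Data.Nat using (ℕ; suc; _≤_)
open import Data.Nat.Divisibility using (_∣_)
open import Data.Fin using (Fin)
open import Data.Product using (_×_)
open import Relation.Nullary using (¬_)

open import Algebra.Bundles using (CommutativeRing)
open import Data.Bool using (Bool; true; false; not; _∧_; _xor_)
open import Data.Bool.Properties using (not-involutive; xor-assoc; xor-same; xor-identityʳ; xor-inverseʳ; xor-∧-commutativeRing)
open import Data.Empty using (⊥-elim)
open import Data.Fin using (toℕ; fromℕ<) renaming (zero to fzero; suc to fsuc)
open import Data.Fin.Properties using (toℕ-fromℕ<; fromℕ<-cong; toℕ-injective; toℕ<n)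
open import Data.List using (length; filter; tabulate)
open import Data.Nat using (zero; _+_; _*_; _∸_; _^_; _<_; _<?_; NonZero; s≤s)
open import Data.Nat.DivMod
open import Data.Nat.Divisibility using (divides; m%n≡0⇒n∣m)
open import Data.Nat.Properties
open import Data.Product using (_,_)
open import Function.Bundles using (_⇔_; mk⇔)
open import Function.Definitions using (Injective)
open import Relation.Binary using (tri<; tri≈; tri>)
open import Relation.Nullary using (does; Dec)
open import Relation.Nullary.Decidable using (dec-true; dec-false; does-⇔; _×-dec_)
open import Relation.Binary.PropositionalEquality
open import Algebra.Properties.CommutativeSemigroup (CommutativeRing.+-commutativeSemigroup xor-∧-commutativeRing) using (interchange)

open ≡-Reasoning

odd : ℕ → Bool
odd zero    = false
odd (suc m) = not (odd m)

even⇒¬odd : ∀ {m} → 2 ∣ m → odd m ≡ false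
even⇒¬odd (divides zero    refl) = refl
even⇒¬odd (divides (suc q) refl) =
  trans (not-involutive (odd (q * 2))) (even⇒¬odd (divides q refl))

odd⇒¬even : ∀ {m} → odd m ≡ true → ¬ (2 ∣ m)
odd⇒¬even m-odd 2∣m with trans (sym m-odd) (even⇒¬odd 2∣m)
... | ()

2∣x+x : ∀ x → 2 ∣ x + x
2∣x+x x = divides x (trans (cong (x +_) (sym (+-identityʳ x))) (*-comm 2 x))

odd-modulus : ∀ n → 1 ≤ n → odd (modulus n) ≡ true
odd-modulus (suc n) _ = cong not (even⇒¬odd (divides (2 ^ n) (*-comm 2 (2 ^ n))))

odd⇒≢negation : ∀ {d x} → odd d ≡ true → x ≤ d → x ≢ d ∸ x
odd⇒≢negation {d} {x} d-odd x≤d x≡d∸x =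
  odd⇒¬even d-odd (subst (2 ∣_) x+x≡d (2∣x+x x))
  where
  x+x≡d : x + x ≡ d
  x+x≡d = trans (cong (_+ x) x≡d∸x) (m∸n+n≡m x≤d)

%-cong-+ˡ : ∀ c a b d .{{_ : NonZero d}} → a % d ≡ b % d → (c + a) % d ≡ (c + b) % d
%-cong-+ˡ c a b d a≡b = begin
  (c + a) % d          ≡⟨ %-distribˡ-+ c a d ⟩
  (c % d + a % d) % d  ≡⟨ cong (λ z → (c % d + z) % d) a≡b ⟩
  (c % d + b % d) % d  ≡⟨ sym (%-distribˡ-+ c b d) ⟩
  (c + b) % d          ∎

%-absorbʳ-* : ∀ a b d .{{_ : NonZero d}} → (a * (b % d)) % d ≡ (a * b) % d
%-absorbʳ-* a b d = begin
  (a * (b % d)) % d            ≡⟨ %-distribˡ-* a (b % d) d ⟩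
  ((a % d) * (b % d % d)) % d  ≡⟨ cong (λ z → ((a % d) * z) % d) (m%n%n≡m%n b d) ⟩
  ((a % d) * (b % d)) % d      ≡⟨ sym (%-distribˡ-* a b d) ⟩
  (a * b) % d                  ∎

-- Since P ≡ -1 modulo P + 1, multiplying by P negates every x in {1,…,P}.
*-negates : ∀ P x → 1 ≤ x → x ≤ P → (P * x) % suc P ≡ suc P ∸ x
*-negates P (suc y) _ y<P = begin
  (P * suc y) % suc P              ≡⟨ cong (_% suc P) P*[1+y]≡ ⟩
  (P ∸ y + y * suc P) % suc P      ≡⟨ [m+kn]%n≡m%n (P ∸ y) y (suc P) ⟩
  (P ∸ y) % suc P                  ≡⟨ m<n⇒m%n≡m (s≤s (m∸n≤m P y)) ⟩
  P ∸ y                            ∎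
  where
  P*[1+y]≡ : P * suc y ≡ P ∸ y + y * suc P
  P*[1+y]≡ = begin
    P * suc y                ≡⟨ *-suc P y ⟩
    P + P * y                ≡⟨ cong₂ _+_ (sym (m∸n+n≡m (<⇒≤ y<P))) (*-comm P y) ⟩
    (P ∸ y + y) + y * P      ≡⟨ +-assoc (P ∸ y) y (y * P) ⟩
    P ∸ y + (y + y * P)      ≡⟨ cong (P ∸ y +_) (sym (*-suc y P)) ⟩
    P ∸ y + y * suc P        ∎

-- Doubling has no fixed point among the nonzero residues modulo d:
-- 2x ≡ x would make x a multiple of d.
double-no-fixpoint : ∀ d .{{_ : NonZero d}} {x} → 1 ≤ x → x < d → (2 * x) % d ≢ x
double-no-fixpoint d {x} 1≤x x<d 2x%d≡x = absurd ((2 * x) / d) x≡q*d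
  where
  x≡q*d : x ≡ ((2 * x) / d) * d
  x≡q*d = +-cancelˡ-≡ x x _ (begin
    x + x                             ≡⟨ cong (x +_) (sym (+-identityʳ x)) ⟩
    2 * x                             ≡⟨ m≡m%n+[m/n]*n (2 * x) d ⟩
    (2 * x) % d + ((2 * x) / d) * d   ≡⟨ cong (_+ ((2 * x) / d) * d) 2x%d≡x ⟩
    x + ((2 * x) / d) * d             ∎)
  absurd : ∀ q → x ≢ q * d
  absurd zero    x≡0   = <⇒≱ 1≤x (≤-reflexive x≡0)
  absurd (suc q) x≡d+q = <⇒≱ x<d (subst (d ≤_) (sym x≡d+q) (m≤m+n d (q * d)))

∣-double⇒≡ : ∀ {r s} → s ≢ 0 → s < r → r ∣ s + s → s + s ≡ r
∣-double⇒≡ {s = s} s≢0 _ (divides zero s+s≡0) = ⊥-elim (s≢0 (m+n≡0⇒m≡0 s s+s≡0))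
∣-double⇒≡ {r} _ _ (divides 1 s+s≡r) = trans s+s≡r (+-identityʳ r)
∣-double⇒≡ {r} _ s<r (divides (suc (suc q)) s+s≡r+r+qr) =
  ⊥-elim (<-irrefl refl (<-≤-trans (+-mono-< s<r s<r)
    (≤-trans (+-monoʳ-≤ r (m≤m+n r (q * r))) (≤-reflexive (sym s+s≡r+r+qr)))))

does-<-swap : ∀ {x y} → x ≢ y → does (x <? y) ≡ not (does (y <? x))
does-<-swap {x} {y} x≢y with <-cmp x y
... | tri< x<y _ _ = trans (dec-true (x <? y) x<y) (sym (cong not (dec-false (y <? x) (<-asym x<y))))
... | tri≈ _ x≡y _ = ⊥-elim (x≢y x≡y)
... | tri> _ _ y<x = trans (dec-false (x <? y) (<-asym y<x)) (sym (cong not (dec-true (y <? x) y<x)))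

∸-<-flip : ∀ {m x y} → y ≤ m → (m ∸ y < m ∸ x ⇔ x < y)
∸-<-flip {m} {x} {y} y≤m = mk⇔
  (λ m∸y<m∸x → ≰⇒> (λ y≤x → <⇒≱ m∸y<m∸x (∸-monoʳ-≤ m y≤x)))
  (λ x<y → ∸-monoʳ-< x<y y≤m)

-- xorSum F m = F 0 xor … xor F (m-1): the parity of #{j < m | F j}.
xorSum : (ℕ → Bool) → ℕ → Bool
xorSum F zero    = false
xorSum F (suc m) = F 0 xor xorSum (λ j → F (suc j)) m

xorSum-cong : ∀ {F G} m → (∀ j → F j ≡ G j) → xorSum F m ≡ xorSum G m
xorSum-cong zero    F≗G = refl
xorSum-cong (suc m) F≗G = cong₂ _xor_ (F≗G 0) (xorSum-cong m (λ j → F≗G (suc j)))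

xorSum-+ : ∀ F a c → xorSum F (a + c) ≡ xorSum F a xor xorSum (λ j → F (a + j)) c
xorSum-+ F zero    c = refl
xorSum-+ F (suc a) c = trans (cong (F 0 xor_) (xorSum-+ (λ j → F (suc j)) a c))
                             (sym (xor-assoc (F 0) _ _))

xorSum-xor : ∀ F G m → xorSum (λ j → F j xor G j) m ≡ xorSum F m xor xorSum G m
xorSum-xor F G zero    = refl
xorSum-xor F G (suc m) =
  trans (cong ((F 0 xor G 0) xor_) (xorSum-xor (λ j → F (suc j)) (λ j → G (suc j)) m))
        (interchange (F 0) (G 0) _ _)

xorSum-telescope : ∀ c m → xorSum (λ j → c j xor c (suc j)) m ≡ c 0 xor c m
xorSum-telescope c zero    = sym (xor-same (c 0))
xorSum-telescope c (suc m) = begin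
  (c 0 xor c 1) xor xorSum (λ j → c (suc j) xor c (suc (suc j))) m
    ≡⟨ cong ((c 0 xor c 1) xor_) (xorSum-telescope (λ j → c (suc j)) m) ⟩
  (c 0 xor c 1) xor (c 1 xor c (suc m))
    ≡⟨ xor-assoc (c 0) (c 1) _ ⟩
  c 0 xor (c 1 xor (c 1 xor c (suc m)))
    ≡⟨ cong (c 0 xor_) (sym (xor-assoc (c 1) (c 1) _)) ⟩
  c 0 xor ((c 1 xor c 1) xor c (suc m))
    ≡⟨ cong (λ z → c 0 xor (z xor c (suc m))) (xor-same (c 1)) ⟩
  c 0 xor c (suc m) ∎

odd-count : ∀ {A : Set} {P : A → Set} (P? : (x : A) → Dec (P x)) {m} (g : Fin m → A)
  (G : ℕ → Bool) → (∀ i → does (P? (g i)) ≡ G (toℕ i)) →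
  odd (length (filter P? (tabulate g))) ≡ xorSum G m
odd-count P? {zero}  g G P?≗G = refl
odd-count P? {suc m} g G P?≗G rewrite sym (P?≗G fzero) with does (P? (g fzero))
... | true  = cong not (odd-count P? (λ i → g (fsuc i)) (λ j → G (suc j)) (λ i → P?≗G (fsuc i)))
... | false = odd-count P? (λ i → g (fsuc i)) (λ j → G (suc j)) (λ i → P?≗G (fsuc i))

rise-xor-fall : ∀ x y → (not x ∧ y) xor (x ∧ not y) ≡ x xor y
rise-xor-fall true  y = refl
rise-xor-fall false y = xor-identityʳ y

-- Rises in the second half are the
-- falls of the first half, and rises plus falls telescope.
antiperiodic-rises-odd : (b : ℕ → Bool) (h k : ℕ) → suc k ≡ h + h →
  (∀ j → b (j + h) ≡ not (b j)) → xorSum (λ j → not (b (j + k)) ∧ b j) (suc k) ≡ true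
antiperiodic-rises-odd b h k period antiperiodic = begin
  xorSum rise (suc k)                               ≡⟨ cong (xorSum rise) period ⟩
  xorSum rise (h + h)                               ≡⟨ xorSum-+ rise h h ⟩
  xorSum rise h xor xorSum (λ j → rise (h + j)) h   ≡⟨ cong (xorSum rise h xor_) (xorSum-cong h second-half) ⟩
  xorSum rise h xor xorSum fall h                   ≡⟨ sym (xorSum-xor rise fall h) ⟩
  xorSum (λ j → rise j xor fall j) h                ≡⟨ xorSum-cong h change ⟩
  xorSum (λ j → prev j xor prev (suc j)) h          ≡⟨ xorSum-telescope prev h ⟩
  b k xor prev h                                    ≡⟨ cong (b k xor_) (trans (cong b (+-comm h k)) (antiperiodic k)) ⟩
  b k xor not (b k)                                 ≡⟨ xor-inverseʳ (b k) ⟩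
  true                                              ∎
  where
  prev : ℕ → Bool
  prev j = b (j + k)
  rise fall : ℕ → Bool
  rise j = not (prev j) ∧ b j
  fall j = prev j ∧ not (b j)

  periodic : ∀ j → prev (suc j) ≡ b j
  periodic j = begin
    b (suc (j + k))   ≡⟨ cong b (trans (sym (+-suc j k)) (cong (j +_) period)) ⟩
    b (j + (h + h))   ≡⟨ cong b (sym (+-assoc j h h)) ⟩
    b (j + h + h)     ≡⟨ antiperiodic (j + h) ⟩
    not (b (j + h))   ≡⟨ cong not (antiperiodic j) ⟩
    not (not (b j))   ≡⟨ not-involutive (b j) ⟩
    b j               ∎

  second-half : ∀ j → rise (h + j) ≡ fall j
  second-half j = cong₂ _∧_
    (trans (cong (λ i → not (b i)) (trans (+-assoc h j k) (+-comm h (j + k))))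
           (trans (cong not (antiperiodic (j + k))) (not-involutive (prev j))))
    (trans (cong b (+-comm h j)) (antiperiodic j))

  change : ∀ j → rise j xor fall j ≡ prev j xor prev (suc j)
  change j = trans (rise-xor-fall (prev j) (b j)) (cong (prev j xor_) (sym (periodic j)))

-- Note that prevIdx i and nextIdx i are by definition the reductions of
-- toℕ i + k and suc (toℕ i), so σ̂ reads neighbours off directly.
module CyclicExtension {k : ℕ} (σ : Fin (suc k) → ℕ) where

  reduce : ℕ → Fin (suc k)
  reduce j = fromℕ< (m%n<n j (suc k))

  σ̂ : ℕ → ℕ
  σ̂ j = σ (reduce j)

  σ̂-cong : ∀ a b → a % suc k ≡ b % suc k → σ̂ a ≡ σ̂ b
  σ̂-cong a b a≡b = cong σ (fromℕ<-cong _ _ a≡b (m%n<n a (suc k)) (m%n<n b (suc k)))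

  σ̂-periodic : ∀ j → σ̂ (j + suc k) ≡ σ̂ j
  σ̂-periodic j = σ̂-cong (j + suc k) j ([m+n]%n≡m%n j (suc k))

  σ̂-toℕ : ∀ i → σ̂ (toℕ i) ≡ σ i
  σ̂-toℕ i = cong σ (toℕ-injective (trans (toℕ-fromℕ< _) (m<n⇒m%n≡m (toℕ<n i))))

  σ̂-suc : ∀ j → σ̂ (suc j) ≡ σ (nextIdx (reduce j))
  σ̂-suc j = σ̂-cong (suc j) (suc (toℕ (reduce j))) (%-cong-+ˡ 1 j (toℕ (reduce j)) (suc k)
    (trans (sym (m%n%n≡m%n j (suc k))) (cong (_% suc k) (sym (toℕ-fromℕ< (m%n<n j (suc k)))))))

  σ̂-injective : Injective _≡_ _≡_ σ → ∀ a b → σ̂ a ≡ σ̂ b → a % suc k ≡ b % suc k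
  σ̂-injective σ-inj a b σ̂a≡σ̂b =
    trans (sym (toℕ-fromℕ< _)) (trans (cong toℕ (σ-inj σ̂a≡σ̂b)) (toℕ-fromℕ< _))

module OrbitStructure (n : ℕ) (n≥1 : 1 ≤ n) (k : ℕ) (σ : Fin (suc k) → ℕ)
                      (orbit : IsOrbit n k σ) where
  open IsOrbit orbit
  open CyclicExtension σ

  M : ℕ
  M = modulus n

  σ̂<M : ∀ j → σ̂ j < M
  σ̂<M j = s≤s (entry-bound (reduce j))

  σ̂-double : ∀ j → σ̂ (suc j) ≡ (2 * σ̂ j) % M
  σ̂-double j = trans (σ̂-suc j) (doubling (reduce j))

  σ̂-pow : ∀ j t → σ̂ (j + t) ≡ (2 ^ t * σ̂ j) % M
  σ̂-pow j zero = begin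
    σ̂ (j + 0)          ≡⟨ cong σ̂ (+-identityʳ j) ⟩
    σ̂ j                ≡⟨ sym (m<n⇒m%n≡m (σ̂<M j)) ⟩
    σ̂ j % M            ≡⟨ cong (_% M) (sym (*-identityˡ (σ̂ j))) ⟩
    (1 * σ̂ j) % M      ∎
  σ̂-pow j (suc t) = begin
    σ̂ (j + suc t)                     ≡⟨ cong σ̂ (+-suc j t) ⟩
    σ̂ (suc (j + t))                   ≡⟨ σ̂-double (j + t) ⟩
    (2 * σ̂ (j + t)) % M               ≡⟨ cong (λ z → (2 * z) % M) (σ̂-pow j t) ⟩
    (2 * ((2 ^ t * σ̂ j) % M)) % M     ≡⟨ %-absorbʳ-* 2 (2 ^ t * σ̂ j) M ⟩
    (2 * (2 ^ t * σ̂ j)) % M           ≡⟨ cong (_% M) (sym (*-assoc 2 (2 ^ t) (σ̂ j))) ⟩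
    (2 ^ suc t * σ̂ j) % M             ∎

  -- Shifting by n negates, because 2^n ≡ -1 modulo M.
  σ̂-antipode : ∀ j → σ̂ (j + n) ≡ M ∸ σ̂ j
  σ̂-antipode j = trans (σ̂-pow j n) (*-negates (2 ^ n) (σ̂ j) (entry-pos (reduce j)) (entry-bound (reduce j)))

  -- Consecutive entries differ, since doubling fixes no nonzero residue.
  σ̂-step-distinct : ∀ j → σ̂ (suc j) ≢ σ̂ j
  σ̂-step-distinct j eq =
    double-no-fixpoint M (entry-pos (reduce j)) (σ̂<M j) (trans (sym (σ̂-double j)) eq)

  half : ℕ
  half = n % suc k

  σ̂-half : ∀ j → σ̂ (j + half) ≡ M ∸ σ̂ j
  σ̂-half j = trans (σ̂-cong (j + half) (j + n) (%-cong-+ˡ j half n (suc k) (m%n%n≡m%n n (suc k)))) (σ̂-antipode j)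

  -- The length is twice the half period: shifting by n is not the identity
  -- (M is odd), but shifting by 2n is.
  length-double : suc k ≡ half + half
  length-double = sym (∣-double⇒≡ half≢0 (m%n<n n (suc k)) (m%n≡0⇒n∣m _ (suc k) [h+h]%r≡0))
    where
    half≢0 : half ≢ 0
    half≢0 h≡0 = odd⇒≢negation (odd-modulus n n≥1) (<⇒≤ (σ̂<M 0))
      (trans (sym (σ̂-cong n 0 h≡0)) (σ̂-antipode 0))
    σ̂[n+n]≡σ̂0 : σ̂ (n + n) ≡ σ̂ 0
    σ̂[n+n]≡σ̂0 = trans (σ̂-antipode n)
      (trans (cong (M ∸_) (σ̂-antipode 0)) (m∸[m∸n]≡n (<⇒≤ (σ̂<M 0))))
    [h+h]%r≡0 : (half + half) % suc k ≡ 0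
    [h+h]%r≡0 = trans (sym (%-distribˡ-+ n n (suc k))) (σ̂-injective distinct (n + n) 0 σ̂[n+n]≡σ̂0)

  -- The descent indicator is antiperiodic with half-period h, since
  -- negation reverses order.
  descent : ℕ → Bool
  descent j = does (σ̂ (suc j) <? σ̂ j)

  descent-antiperiodic : ∀ j → descent (j + half) ≡ not (descent j)
  descent-antiperiodic j = begin
    does (σ̂ (suc j + half) <? σ̂ (j + half))     ≡⟨ cong₂ (λ a c → does (a <? c)) (σ̂-half (suc j)) (σ̂-half j) ⟩
    does (M ∸ σ̂ (suc j) <? M ∸ σ̂ j)            ≡⟨ does-⇔ (∸-<-flip (<⇒≤ (σ̂<M (suc j)))) (M ∸ σ̂ (suc j) <? M ∸ σ̂ j) (σ̂ j <? σ̂ (suc j)) ⟩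
    does (σ̂ j <? σ̂ (suc j))                     ≡⟨ does-<-swap (λ eq → σ̂-step-distinct j (sym eq)) ⟩
    not (descent j)                              ∎

  peak≡rise : ∀ j → does ((σ̂ (j + k) <? σ̂ j) ×-dec (σ̂ (suc j) <? σ̂ j))
                  ≡ not (descent (j + k)) ∧ descent j
  peak≡rise j = cong (_∧ descent j) (begin
    does (σ̂ (j + k) <? σ̂ j)          ≡⟨ does-<-swap (λ eq → σ̂-step-distinct (j + k) (trans wrap (sym eq))) ⟩
    not (does (σ̂ j <? σ̂ (j + k)))    ≡⟨ cong (λ z → not (does (z <? σ̂ (j + k)))) (sym wrap) ⟩
    not (descent (j + k))             ∎)
    where
    wrap : σ̂ (suc (j + k)) ≡ σ̂ j
    wrap = trans (cong σ̂ (sym (+-suc j k))) (σ̂-periodic j)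

  odd-numLocalMax : odd (numLocalMax σ) ≡ true
  odd-numLocalMax = begin
    odd (numLocalMax σ)                                ≡⟨ odd-count isPeak? (λ i → i) peak at-index ⟩
    xorSum peak (suc k)                                ≡⟨ xorSum-cong (suc k) peak≡rise ⟩
    xorSum (λ j → not (descent (j + k)) ∧ descent j) (suc k)
      ≡⟨ antiperiodic-rises-odd descent half k length-double descent-antiperiodic ⟩
    true                                               ∎
    where
    isPeak? : (i : Fin (suc k)) → Dec (IsLocalMax σ i)
    isPeak? i = (σ (prevIdx i) <? σ i) ×-dec (σ (nextIdx i) <? σ i)
    peak : ℕ → Bool
    peak j = does ((σ̂ (j + k) <? σ̂ j) ×-dec (σ̂ (suc j) <? σ̂ j))
    at-index : ∀ i → does (isPeak? i) ≡ peak (toℕ i)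
    at-index i = cong (λ z → does ((σ (prevIdx i) <? z) ×-dec (σ (nextIdx i) <? z))) (sym (σ̂-toℕ i))

lemma5p2 : (n : ℕ) → 1 ≤ n → (k : ℕ) → (σ : Fin (suc k) → ℕ) → IsOrbit n k σ →
    (2 ∣ orbitLength σ) × (¬ (2 ∣ numLocalMax σ))
lemma5p2 n n≥1 k σ orbit =
  subst (2 ∣_) (sym length-double) (2∣x+x half) , odd⇒¬even odd-numLocalMax
  where open OrbitStructure n n≥1 k σ orbit
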